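{- Let $G$ and $G'$ be non-isomorphic triconnected planar graphs, $G$ with $n$ vertices, $C$ a collocated configuration in $G$ and $C'$ a twisted configuration in $G'$. Consider a position of the Ehrenfeucht–Fraïssé game on $G,G'$ in which the vertices of $C$ and $C'$ carrying the same label are covered by the same pebble, and additionally $a,b\in V(G)$ and $a',b'\in V(G')$ are pebbled ($a$ and $a'$ by one pebble, $b$ and $b'$ by another) with $d_0(a,b)\ne d_0(a',b')$. Then from this position Spoiler wins with 9 pebbles in fewer than $\log_2 n+2$ rounds.
   Context: An $X$-configuration is a set of 5 pairwise distinct vertices labelled $x,y,u,v,w$ with $x,y,u,v$ adjacent to $w$; an $H$-configuration is a set of 6 pairwise distinct vertices labelled $x,y,z,u,v,w$ with $z$ adjacent to $w$, $x,y$ adjacent to $z$, $u,v$ adjacent to $w$; for an $X$-configuration set $z=w$. In a triconnected planar graph (unique spherical embedding up to equivalence by Whitney's theorem), an $X$-configuration is collocated if $u,x,y,v$ occur around $w$ in this cyclic order (up to cyclic shift and reversal); an $H$-configuration is collocated if $x,z,w,u$ and $y,z,w,v$ are segments of the two facial cycles containing the edge $zw$. A twisted configuration is obtained from a collocated one by swapping the labels $x$ and $y$. A path avoids $C$ if none of its non-endpoint vertices lies in $C$; $d_0(a,b)$ in $G$ is the minimum length of an $a$-$b$-path avoiding $C$ ($\infty$ if none), and in $G'$ the same with respect to $C'$. Game: each pebble has two copies; in each round Spoiler places (possibly moves) a copy of some pebble on a vertex of one graph and Duplicator places the other copy on a vertex of the other graph; Duplicator wins as long as the correspondence between vertices carrying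 the same pebble is a partial isomorphism (respects equality and adjacency); Spoiler wins within $r$ rounds if he can force this to fail within $r$ rounds against any Duplicator strategy. -}

module Defs where

open import Data.Bool using (Bool; true; false; _∧_; if_then_else_)
open import Data.Nat using (ℕ; zero; suc; _+_; _*_; _<_; _≤_; _≤ᵇ_; _<ᵇ_)
open import Data.Fin using (Fin; toℕ; fromℕ; inject₁) renaming (zero to fzero; suc to fsuc)
import Data.Fin as F
open import Data.List using (List; []; _∷_; length; filterᵇ; allFin; map; concatMap; upTo)
open import Data.Bool.ListAction using (and)
open import Data.List.Membership.Propositional using (_∈_; _∉_)
open import Data.List.Relation.Unary.Unique.Propositional using (Unique)
open import Data.Maybe using (Maybe; just; nothing)
open import Data.Product using (Σ; ∃; _×_; _,_; proj₁; proj₂)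
open import Data.Sum using (_⊎_)
open import Data.Empty using (⊥)
open import Relation.Nullary using (¬_; does)
open import Relation.Binary.PropositionalEquality using (_≡_; _≢_)
open import Function.Bundles using (_↔_; Inverse)

record Graph (n : ℕ) : Set where
  field
    adj    : Fin n → Fin n → Bool
    sym    : ∀ u v → adj u v ≡ adj v u
    irrefl : ∀ u → adj u u ≡ false

open Graph public

Adj : ∀ {n} → Graph n → Fin n → Fin n → Set
Adj G u v = adj G u v ≡ true

Isomorphic : ∀ {n n'} → Graph n → Graph n' → Set
Isomorphic {n} {n'} G G' =
  Σ (Fin n ↔ Fin n') λ f →
    ∀ u v → adj G' (Inverse.to f u) (Inverse.to f v) ≡ adj G u v

record AvoidingPath {n} (G : Graph n) (S : List (Fin n)) (a b : Fin n) (ℓ : ℕ) : Set where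
  field
    vtx      : Fin (suc ℓ) → Fin n
    start    : vtx fzero ≡ a
    end      : vtx (fromℕ ℓ) ≡ b
    step     : ∀ (i : Fin ℓ) → Adj G (vtx (inject₁ i)) (vtx (fsuc i))
    distinct : ∀ i j → vtx i ≡ vtx j → i ≡ j
    avoids   : ∀ (i : Fin (suc ℓ)) → i ≢ fzero → i ≢ fromℕ ℓ → vtx i ∉ S

-- Triconnected: more than 3 vertices, and removing any set of at most two
-- vertices {s,t} (s = t allowed) leaves a connected graph.
Triconnected : ∀ {n} → Graph n → Set
Triconnected {n} G =
  (4 ≤ n) ×
  (∀ (s t u v : Fin n) → u ∉ (s ∷ t ∷ []) → v ∉ (s ∷ t ∷ []) →
     ∃ λ ℓ → AvoidingPath G (s ∷ t ∷ []) u v ℓ)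

-- d₀-values: `IsDist G S a b d` says that the minimum length of an a-b-path
-- avoiding S is d (nothing = ∞, i.e. no such path exists).
IsDist : ∀ {n} → Graph n → List (Fin n) → Fin n → Fin n → Maybe ℕ → Set
IsDist G S a b (just ℓ) = AvoidingPath G S a b ℓ × (∀ m → AvoidingPath G S a b m → ℓ ≤ m)
IsDist G S a b nothing  = ∀ m → ¬ AvoidingPath G S a b m

iter : ∀ {A : Set} → (A → A) → ℕ → A → A
iter f zero    x = x
iter f (suc k) x = f (iter f k x)

countᵇ : ∀ {A : Set} → (A → Bool) → List A → ℕ
countᵇ p xs = length (filterᵇ p xs)

allPairs : ∀ n → List (Fin n × Fin n)
allPairs n = concatMap (λ u → map (λ v → (u , v)) (allFin n)) (allFin n)

module _ {n} (G : Graph n) (rot : Fin n → Fin n → Fin n) where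
  -- face permutation on darts: (u,v) ↦ (v, successor of u in the rotation at v)
  faceNext : Fin n × Fin n → Fin n × Fin n
  faceNext (u , v) = (v , rot v u)

  key : Fin n × Fin n → ℕ
  key (u , v) = toℕ u * n + toℕ v

  -- a dart is the representative of its face if it is key-minimal in its
  -- faceNext-orbit (orbits have size ≤ number of darts ≤ n * n)
  isFaceRep : Fin n × Fin n → Bool
  isFaceRep d = and (map (λ k → key d ≤ᵇ key (iter faceNext k d)) (upTo (n * n)))

  numFaces : ℕ
  numFaces = countᵇ (λ d → adj G (proj₁ d) (proj₂ d) ∧ isFaceRep d) (allPairs n)

numEdges : ∀ {n} → Graph n → ℕ
numEdges {n} G = countᵇ (λ d → (toℕ (proj₁ d) <ᵇ toℕ (proj₂ d)) ∧ adj G (proj₁ d) (proj₂ d)) (allPairs n)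

-- A spherical embedding of G: for each vertex w, `rot w` restricts to a cyclic
-- permutation of the neighbourhood of w, and Euler's formula V - E + F = 2 holds.
record Embedding {n} (G : Graph n) : Set where
  field
    rot       : Fin n → Fin n → Fin n
    rot-adj   : ∀ w u → Adj G w u → Adj G w (rot w u)
    rot-inj   : ∀ w u u' → Adj G w u → Adj G w u' → rot w u ≡ rot w u' → u ≡ u'
    rot-cycle : ∀ w u u' → Adj G w u → Adj G w u' → ∃ λ k → iter (rot w) k u ≡ u'
    euler     : n + numFaces G rot ≡ 2 + numEdges G

open Embedding public

data Kind : Set where
  X H : Kind

record Config {n} (G : Graph n) : Set where
  field
    kind : Kind
    x y z u v w : Fin n
    valid : (kind ≡ X × Unique (x ∷ y ∷ u ∷ v ∷ w ∷ []) × z ≡ w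
               × Adj G x w × Adj G y w × Adj G u w × Adj G v w)
          ⊎ (kind ≡ H × Unique (x ∷ y ∷ z ∷ u ∷ v ∷ w ∷ [])
               × Adj G z w × Adj G x z × Adj G y z × Adj G u w × Adj G v w)

open Config public

vertices : ∀ {n} {G : Graph n} → Config G → List (Fin n)
vertices C = x C ∷ y C ∷ z C ∷ u C ∷ v C ∷ w C ∷ []

module _ {n} {G : Graph n} (E : Embedding G) where
  CyclicOrder : Fin n → Fin n → Fin n → Fin n → Fin n → Set
  CyclicOrder w a b c d =
    Σ ℕ λ i → Σ ℕ λ j → Σ ℕ λ k →
      (0 < i) × (i < j) × (j < k)
      × iter (rot E w) i a ≡ b × iter (rot E w) j a ≡ c × iter (rot E w) k a ≡ d
      × (∀ m → 0 < m → m ≤ k → iter (rot E w) m a ≢ a)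

  -- a, b, c, d are consecutive along a facial walk (a→b→c→d)
  FaceSegment : Fin n → Fin n → Fin n → Fin n → Set
  FaceSegment a b c d = rot E b a ≡ c × rot E c b ≡ d

  CollocatedLabels : Kind → (x y z u v w : Fin n) → Set
  CollocatedLabels X x y z u v w = CyclicOrder w u x y v ⊎ CyclicOrder w v y x u
  -- the two facial cycles through zw are those of the darts (z,w) and (w,z)
  CollocatedLabels H x y z u v w =
      (FaceSegment x z w u × FaceSegment v w z y)
    ⊎ (FaceSegment u w z x × FaceSegment y z w v)

  Collocated : Config G → Set
  Collocated C = CollocatedLabels (kind C) (x C) (y C) (z C) (u C) (v C) (w C)

  Twisted : Config G → Set
  Twisted C = CollocatedLabels (kind C) (y C) (x C) (z C) (u C) (v C) (w C)

Position : ℕ → ℕ → ℕ → Set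
Position n n' k = Fin k → Maybe (Fin n × Fin n')

PartialIso : ∀ {n n' k} → Graph n → Graph n' → Position n n' k → Set
PartialIso G G' p =
  ∀ i j a a' b b' → p i ≡ just (a , a') → p j ≡ just (b , b') →
    ((a ≡ b → a' ≡ b') × (a' ≡ b' → a ≡ b)) × adj G a b ≡ adj G' a' b'

place : ∀ {n n' k} → Position n n' k → Fin k → Fin n × Fin n' → Position n n' k
place p i vv j = if does (i F.≟ j) then just vv else p j

SpoilerWins : ∀ {n n' k} → Graph n → Graph n' → ℕ → Position n n' k → Set
SpoilerWins G G' zero    p = ¬ PartialIso G G' p
SpoilerWins {n} {n'} {k} G G' (suc r) p =
    ¬ PartialIso G G' p
  ⊎ (Σ (Fin k) λ i →
       (Σ (Fin n) λ a → ∀ (a' : Fin n') → SpoilerWins G G' r (place p i (a , a')))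
     ⊎ (Σ (Fin n') λ a' → ∀ (a : Fin n) → SpoilerWins G G' r (place p i (a , a'))))

{-# OPTIONS --safe #-}
-- The six configuration pebbles never move, so Duplicator cannot answer a vertex outside C by one of C′,
-- and walks avoiding C can be cut and glued at any other pebbled pair of vertices.  If
-- d₀(a,b) < d₀(a′,b′) (or symmetrically), Spoiler pebbles the midpoint c of a shortest a–b walk avoiding C;
-- whatever c′ Duplicator answers, the a′–c′ or the c′–b′ distance exceeds the corresponding half, so
-- after ⌈log₂ n⌉ halvings with three moving pebbles equality or adjacency breaks.  When d₀(a,b) = ∞ and
-- d₀(a′,b′) > n, one extra round pebbling the vertex at d₀-distance n from a′ on a shortest a′–b′ path
-- reduces to the first case, because every finite d₀-value in G is below n.

module Submission where

open import Defs
open import Data.Nat using (ℕ; _<_; _∸_; _^_)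
open import Data.Fin using (Fin; #_)
open import Data.Maybe using (Maybe; just)
open import Data.Product using (Σ; _×_; _,_)
open import Relation.Nullary using (¬_)
open import Relation.Binary.PropositionalEquality using (_≡_; _≢_)

open import Data.Nat using (zero; suc; _+_; _*_; _≤_; _≤?_; z≤n; s≤s; s≤s⁻¹; ⌊_/2⌋; ⌈_/2⌉)
open import Data.Nat.Properties
open import Data.Nat.Induction using (<-wellFounded)
open import Induction.WellFounded using (Acc; acc)
open import Data.Fin using (fromℕ; inject₁; _↑ˡ_; _↑ʳ_) renaming (zero to fzero; suc to fsuc)
import Data.Fin as Fin
import Data.Bool as Bool
open import Data.Bool using (true; false)
import Data.Fin.Properties as Finₚ
open import Data.List using (List; tabulate; lookup)
open import Data.List.Membership.Propositional using (_∈_; _∉_)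
open import Data.List.Membership.Propositional.Properties using (∈-tabulate⁺; ∈-tabulate⁻)
open import Data.List.Relation.Unary.Any using (any?)
open import Data.Maybe using (nothing)
import Data.Maybe as Maybe
open import Data.Maybe.Relation.Unary.All using (All; just; nothing)
import Data.Maybe.Relation.Unary.All as All
open import Data.Product using (∃; proj₁; proj₂)
import Data.Product as Product
open import Data.Sum using (_⊎_; inj₁; inj₂)
open import Data.Unit using (⊤)
open import Data.Empty using (⊥)
open import Function using (_∘_)
open import Relation.Nullary using (Dec; yes; no; does; ¬?; _×-dec_; contradiction)
open import Relation.Unary using (Decidable)
open import Relation.Binary.Definitions using (tri<; tri≈; tri>)
open import Relation.Binary.PropositionalEquality
  using (refl; trans; cong; subst; subst₂; _≗_; ≢-sym)
import Relation.Binary.PropositionalEquality as ≡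

least-witness : ∀ {P : ℕ → Set} → Decidable P → ∀ {m} → P m →
  ∃ λ ℓ → ℓ ≤ m × P ℓ × (∀ {k} → k < ℓ → ¬ P k)
least-witness {P} P? {m} = go (<-wellFounded m)
  where
  go : ∀ {m} → Acc _<_ m → P m → ∃ λ ℓ → ℓ ≤ m × P ℓ × (∀ {k} → k < ℓ → ¬ P k)
  go {m} (acc smaller) Pm with anyUpTo? P? m
  ... | no none = m , ≤-refl , Pm , λ k<m Pk → none (_ , k<m , Pk)
  ... | yes (k , k<m , Pk) =
    let ℓ , ℓ≤k , Pℓ , minimal = go (smaller k<m) Pk in ℓ , ≤-trans ℓ≤k (<⇒≤ k<m) , Pℓ , minimal

n<2^n : ∀ n → n < 2 ^ n
n<2^n zero = s≤s z≤n
n<2^n (suc n) = +-mono-≤ (m^n>0 2 n) (≤-trans (n<2^n n) (m≤m+n (2 ^ n) 0))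

tight-power-of-2 : ∀ {n} → 2 ≤ n → ∃ λ R → n ≤ 2 ^ R × 2 ^ (R ∸ 1) < n
tight-power-of-2 {n} 2≤n with least-witness (λ R → n ≤? 2 ^ R) {n} (<⇒≤ (n<2^n n))
... | zero , _ , n≤1 , _ = contradiction (≤-trans 2≤n n≤1) λ { (s≤s ()) }
... | suc R , _ , n≤2^[1+R] , below = suc R , n≤2^[1+R] , ≰⇒> (below ≤-refl)

-- Walks whose interior vertices avoid S; unlike AvoidingPath they may repeat vertices.
module AvoidingWalks {n} (G : Graph n) (S : List (Fin n)) where

  data Walk : Fin n → Fin n → ℕ → Set where
    nil  : ∀ {a} → Walk a a 0
    edge : ∀ {a b} → Adj G a b → Walk a b 1
    cons : ∀ {a c b m} → Adj G a c → c ∉ S → Walk c b (suc m) → Walk a b (suc (suc m))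

  walk? : ∀ a b ℓ → Dec (Walk a b ℓ)
  walk? a b zero with a Fin.≟ b
  ... | yes refl = yes nil
  ... | no a≢b = no λ { nil → a≢b refl }
  walk? a b (suc zero) with adj G a b Bool.≟ true
  ... | yes e = yes (edge e)
  ... | no ¬e = no λ { (edge e) → ¬e e }
  walk? a b (suc (suc m))
    with Finₚ.any? (λ c → (adj G a c Bool.≟ true) ×-dec ¬? (any? (c Fin.≟_) S) ×-dec walk? c b (suc m))
  ... | yes (_ , e , c∉S , W) = yes (cons e c∉S W)
  ... | no none = no λ { (cons e c∉S W) → none (_ , e , c∉S , W) }

  _++⟨_⟩_ : ∀ {a c b m₁ m₂} → Walk a c m₁ → c ∉ S → Walk c b m₂ → Walk a b (m₁ + m₂)
  nil          ++⟨ _ ⟩ W = W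
  edge e       ++⟨ _ ⟩ nil = edge e
  edge e       ++⟨ c∉S ⟩ W@(edge _) = cons e c∉S W
  edge e       ++⟨ c∉S ⟩ W@(cons _ _ _) = cons e c∉S W
  cons e c∉S W ++⟨ d∉S ⟩ W′ = cons e c∉S (W ++⟨ d∉S ⟩ W′)

  split : ∀ h₁ {h₂ a b} → Walk a b (suc h₁ + suc h₂) →
    ∃ λ c → c ∉ S × Walk a c (suc h₁) × Walk c b (suc h₂)
  split zero (cons e c∉S W) = _ , c∉S , edge e , W
  split (suc h₁) (cons e c∉S W) =
    let c , c∉S′ , W₁ , W₂ = split h₁ W in c , c∉S′ , cons e c∉S W₁ , W₂

  vertex : ∀ {a b ℓ} → Walk a b ℓ → Fin (suc ℓ) → Fin n
  vertex {a} _ fzero = a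
  vertex nil (fsuc ())
  vertex {b = b} (edge _) (fsuc _) = b
  vertex (cons _ _ W) (fsuc i) = vertex W i

  vertex-end : ∀ {a b ℓ} (W : Walk a b ℓ) → vertex W (fromℕ ℓ) ≡ b
  vertex-end nil = refl
  vertex-end (edge _) = refl
  vertex-end (cons _ _ W) = vertex-end W

  vertex-step : ∀ {a b ℓ} (W : Walk a b ℓ) (i : Fin ℓ) → Adj G (vertex W (inject₁ i)) (vertex W (fsuc i))
  vertex-step (edge e) fzero = e
  vertex-step (cons e _ _) fzero = e
  vertex-step (cons _ _ W) (fsuc i) = vertex-step W i

  vertex-avoids : ∀ {a b ℓ} (W : Walk a b ℓ) (i : Fin (suc ℓ)) → i ≢ fzero → i ≢ fromℕ ℓ → vertex W i ∉ S
  vertex-avoids W fzero i≢0 _ = contradiction refl i≢0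
  vertex-avoids (edge _) (fsuc fzero) _ i≢ℓ = contradiction refl i≢ℓ
  vertex-avoids (cons _ c∉S _) (fsuc fzero) _ _ = c∉S
  vertex-avoids (cons _ _ W) (fsuc (fsuc i)) _ i≢ℓ = vertex-avoids W (fsuc i) (λ ()) (i≢ℓ ∘ cong fsuc)

  suffix : ∀ {a b ℓ} (W : Walk a b ℓ) (j : Fin (suc ℓ)) → ∃ λ m → m ≤ ℓ × Walk (vertex W j) b m
  suffix W fzero = _ , ≤-refl , W
  suffix (edge _) (fsuc fzero) = 0 , z≤n , nil
  suffix (cons _ _ W) (fsuc j) = let m , m≤ℓ , W′ = suffix W j in m , m≤n⇒m≤1+n m≤ℓ , W′

  shortcut : ∀ {a b ℓ} (W : Walk a b ℓ) {i j} → i Fin.< j → vertex W i ≡ vertex W j →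
    ∃ λ m → m < ℓ × Walk a b m
  shortcut (edge _) {fsuc fzero} {fsuc fzero} (s≤s ())
  shortcut (edge _) {fzero} {fsuc fzero} _ a≡b = 0 , s≤s z≤n , subst (λ b → Walk _ b 0) a≡b nil
  shortcut (cons _ _ W) {fzero} {fsuc j} _ a≡c =
    let m , m≤ , W′ = suffix W j in m , s≤s m≤ , subst (λ a → Walk a _ m) (≡.sym a≡c) W′
  shortcut (cons e c∉S W) {fsuc i} {fsuc j} (s≤s i<j) eq =
    let m , m< , W′ = shortcut W i<j eq in suc m , s≤s m< , edge e ++⟨ c∉S ⟩ W′

  shortest⇒path : ∀ {a b ℓ} → Walk a b ℓ → (∀ {m} → m < ℓ → ¬ Walk a b m) → AvoidingPath G S a b ℓ
  shortest⇒path W shortest = record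
    { vtx = vertex W ; start = refl ; end = vertex-end W ; step = vertex-step W
    ; distinct = distinct ; avoids = vertex-avoids W }
    where
    distinct : ∀ i j → vertex W i ≡ vertex W j → i ≡ j
    distinct i j eq with Finₚ.<-cmp i j
    ... | tri< i<j _ _ = let _ , m< , W′ = shortcut W i<j eq in contradiction W′ (shortest m<)
    ... | tri≈ _ i≡j _ = i≡j
    ... | tri> _ _ j<i = let _ , m< , W′ = shortcut W j<i (≡.sym eq) in contradiction W′ (shortest m<)

  sequence⇒walk : ∀ ℓ (v : Fin (suc ℓ) → Fin n) → (∀ i → Adj G (v (inject₁ i)) (v (fsuc i))) →
    (∀ i → i ≢ fzero → i ≢ fromℕ ℓ → v i ∉ S) → Walk (v fzero) (v (fromℕ ℓ)) ℓ
  sequence⇒walk zero v _ _ = nil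
  sequence⇒walk (suc zero) v step _ = edge (step fzero)
  sequence⇒walk (suc (suc ℓ)) v step avoids =
    cons (step fzero) (avoids (fsuc fzero) (λ ()) (λ ()))
      (sequence⇒walk (suc ℓ) (v ∘ fsuc) (step ∘ fsuc)
        λ i _ i≢ℓ → avoids (fsuc i) (λ ()) (i≢ℓ ∘ Finₚ.suc-injective))

  path⇒walk : ∀ {a b ℓ} → AvoidingPath G S a b ℓ → Walk a b ℓ
  path⇒walk {ℓ = ℓ} P = subst₂ (λ a b → Walk a b ℓ) start end (sequence⇒walk ℓ vtx step avoids)
    where open AvoidingPath P

  path-length< : ∀ {a b ℓ} → AvoidingPath G S a b ℓ → ℓ < n
  path-length< P = Finₚ.injective⇒≤ λ {i} {j} → AvoidingPath.distinct P i j

  walk⇒path : ∀ {a b m} → Walk a b m → ∃ λ ℓ → ℓ ≤ m × AvoidingPath G S a b ℓ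
  walk⇒path {a} {b} W =
    let ℓ , ℓ≤m , Wℓ , shortest = least-witness (walk? a b) W in ℓ , ℓ≤m , shortest⇒path Wℓ shortest

  isDist-walk : ∀ {a b ℓ} → IsDist G S a b (just ℓ) → Walk a b ℓ
  isDist-walk (P , _) = path⇒walk P

  isDist-≤ : ∀ {a b ℓ m} → IsDist G S a b (just ℓ) → Walk a b m → ℓ ≤ m
  isDist-≤ (_ , minimal) W = let ℓ₀ , ℓ₀≤m , P = walk⇒path W in ≤-trans (minimal ℓ₀ P) ℓ₀≤m

  isDist-∞ : ∀ {a b m} → IsDist G S a b nothing → ¬ Walk a b m
  isDist-∞ none W = let ℓ , _ , P = walk⇒path W in none ℓ P

  isDist-< : ∀ {a b d} → IsDist G S a b d → All (_< n) d
  isDist-< {d = just _} (P , _) = just (path-length< P)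
  isDist-< {d = nothing} _ = nothing

  shortest⇒isDist : ∀ {a b ℓ} → Walk a b ℓ → (∀ {m} → m < ℓ → ¬ Walk a b m) → IsDist G S a b (just ℓ)
  shortest⇒isDist W shortest =
    shortest⇒path W shortest , λ m P → ≮⇒≥ λ m<ℓ → shortest m<ℓ (path⇒walk P)

  d₀ : ∀ a b → ∃ (IsDist G S a b)
  d₀ a b with anyUpTo? (walk? a b) n
  ... | yes (_ , _ , W) =
    let ℓ , _ , Wℓ , shortest = least-witness (walk? a b) W in just ℓ , shortest⇒isDist Wℓ shortest
  ... | no none = nothing , λ m P → none (m , path-length< P , path⇒walk P)

  isDist-prefix : ∀ ℓ₁ {ℓ₂ a b} → IsDist G S a b (just (ℓ₁ + suc ℓ₂)) → ∃ λ c → IsDist G S a c (just ℓ₁)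
  isDist-prefix zero _ = _ , shortest⇒isDist nil λ ()
  isDist-prefix (suc h₁) {ℓ₂} dist =
    let c , c∉S , W₁ , W₂ = split h₁ (isDist-walk dist)
    in c , shortest⇒isDist W₁ λ m<ℓ₁ W → <⇒≱ (+-monoˡ-< (suc ℓ₂) m<ℓ₁) (isDist-≤ dist (W ++⟨ c∉S ⟩ W₂))

module _ {n n' k : ℕ} where

  place-≡ : ∀ (p : Position n n' k) i vv → place p i vv i ≡ just vv
  place-≡ p i vv with i Fin.≟ i
  ... | yes _ = refl
  ... | no i≢i = contradiction refl i≢i

  place-≢ : ∀ (p : Position n n' k) {i} vv {j} → i ≢ j → place p i vv j ≡ p j
  place-≢ p {i} vv {j} i≢j with i Fin.≟ j
  ... | yes i≡j = contradiction i≡j i≢j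
  ... | no _ = refl

  swap : Position n n' k → Position n' n k
  swap p i = Maybe.map Product.swap (p i)

  swap-just : ∀ (p : Position n n' k) {i a a'} → p i ≡ just (a , a') → swap p i ≡ just (a' , a)
  swap-just _ = cong (Maybe.map Product.swap)

  swap-just⁻ : ∀ (p : Position n n' k) i {a a'} → swap p i ≡ just (a' , a) → p i ≡ just (a , a')
  swap-just⁻ p i eq with p i
  swap-just⁻ p i refl | just _ = refl

  place-swap : ∀ {p : Position n n' k} {q} → q ≗ swap p →
    ∀ i a a' → place q i (a' , a) ≗ swap (place p i (a , a'))
  place-swap q≗ i a a' j with does (i Fin.≟ j)
  ... | true = refl
  ... | false = q≗ j

  module _ {G : Graph n} {G' : Graph n'} where

    ¬PartialIso⇒SpoilerWins : ∀ r {p : Position n n' k} → ¬ PartialIso G G' p → SpoilerWins G G' r p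
    ¬PartialIso⇒SpoilerWins zero ¬iso = ¬iso
    ¬PartialIso⇒SpoilerWins (suc r) ¬iso = inj₁ ¬iso

    partialIso-swap : ∀ {p : Position n n' k} {q} → q ≗ swap p → PartialIso G G' p → PartialIso G' G q
    partialIso-swap {p} q≗ iso i j a' a b' b qi qj =
      let (≡⇒≡′ , ≡′⇒≡) , adj≡ = iso i j a a' b b' (swap-just⁻ p i (trans (≡.sym (q≗ i)) qi))
                                                   (swap-just⁻ p j (trans (≡.sym (q≗ j)) qj))
      in (≡′⇒≡ , ≡⇒≡′) , ≡.sym adj≡

    spoiler-wins-swap : ∀ r {p : Position n n' k} {q} → q ≗ swap p →
      SpoilerWins G' G r q → SpoilerWins G G' r p
    spoiler-wins-swap zero q≗ win = win ∘ partialIso-swap q≗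
    spoiler-wins-swap (suc r) q≗ (inj₁ ¬iso) = inj₁ (¬iso ∘ partialIso-swap q≗)
    spoiler-wins-swap (suc r) q≗ (inj₂ (i , inj₁ (a' , win))) =
      inj₂ (i , inj₂ (a' , λ a → spoiler-wins-swap r (place-swap q≗ i a a') (win a)))
    spoiler-wins-swap (suc r) q≗ (inj₂ (i , inj₂ (a , win))) =
      inj₂ (i , inj₁ (a , λ a' → spoiler-wins-swap r (place-swap q≗ i a a') (win a')))

↑ˡ≢↑ʳ : ∀ {m k} (i : Fin m) (j : Fin k) → i ↑ˡ k ≢ m ↑ʳ j
↑ˡ≢↑ʳ fzero j ()
↑ˡ≢↑ʳ (fsuc i) j eq = ↑ˡ≢↑ʳ i j (Finₚ.suc-injective eq)

m≤2*n⇒⌈m/2⌉≤n : ∀ {m n} → m ≤ 2 * n → ⌈ m /2⌉ ≤ n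
m≤2*n⇒⌈m/2⌉≤n {m} {n} m≤2n = begin
  ⌈ m /2⌉         ≤⟨ ⌈n/2⌉-mono m≤2n ⟩
  ⌈ 2 * n /2⌉     ≡⟨ cong (λ k → ⌈ n + k /2⌉) (+-identityʳ n) ⟩
  ⌈ n + n /2⌉     ≡⟨ ≡.sym (n≡⌈n+n/2⌉ n) ⟩
  n               ∎
  where open ≤-Reasoning

-- The order of d₀-values, reading nothing as ∞.
_≺_ : Maybe ℕ → Maybe ℕ → Set
just ℓ ≺ just ℓ' = ℓ < ℓ'
just _ ≺ nothing = ⊤
nothing ≺ _ = ⊥

≢⇒≺⊎≻ : ∀ {d d'} → d ≢ d' → d ≺ d' ⊎ d' ≺ d
≢⇒≺⊎≻ {just ℓ} {just ℓ'} ℓ≢ℓ' with <-cmp ℓ ℓ'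
... | tri< ℓ<ℓ' _ _ = inj₁ ℓ<ℓ'
... | tri≈ _ ℓ≡ℓ' _ = contradiction (cong just ℓ≡ℓ') ℓ≢ℓ'
... | tri> _ _ ℓ'<ℓ = inj₂ ℓ'<ℓ
≢⇒≺⊎≻ {just _} {nothing} _ = inj₁ _
≢⇒≺⊎≻ {nothing} {just _} _ = inj₂ _
≢⇒≺⊎≻ {nothing} {nothing} ∞≢∞ = contradiction refl ∞≢∞

-- Spoiler only ever moves the last three pebbles f ↑ʳ i.
Pins : ∀ {n n' f} → (Fin f → Fin n) → (Fin f → Fin n') → Position n n' (f + 3) → Set
Pins σ σ' p = ∀ t → p (t ↑ˡ 3) ≡ just (σ t , σ' t)

module Bisection {n n' f} (G : Graph n) (G' : Graph n') (σ : Fin f → Fin n) (σ' : Fin f → Fin n') where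
  private
    S = tabulate σ
    S' = tabulate σ'
    module W = AvoidingWalks G S
    module W' = AvoidingWalks G' S'

  pins-place : ∀ (p : Position n n' (f + 3)) k vv → Pins σ σ' p → Pins σ σ' (place p (f ↑ʳ k) vv)
  pins-place p k vv pins t = trans (place-≢ p vv (≢-sym (↑ˡ≢↑ʳ t k))) (pins t)

  place-moving : ∀ (p : Position n n' (f + 3)) {k i} vv {v} → k ≢ i →
    p (f ↑ʳ i) ≡ v → place p (f ↑ʳ k) vv (f ↑ʳ i) ≡ v
  place-moving p {k} {i} vv k≢i pi = trans (place-≢ p vv (k≢i ∘ Finₚ.↑ʳ-injective f k i)) pi

  pinned-conflict : ∀ {p : Position n n' (f + 3)} k {c c'} → Pins σ σ' p → c ∉ S → c' ∈ S' →
    ¬ PartialIso G G' (place p (f ↑ʳ k) (c , c'))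
  pinned-conflict {p} k {c} {c'} pins c∉S c'∈S' iso =
    let t , c'≡σ't = ∈-tabulate⁻ c'∈S'
        (_ , ≡′⇒≡) , _ = iso (f ↑ʳ k) (t ↑ˡ 3) c c' (σ t) (σ' t) (place-≡ p (f ↑ʳ k) _)
                           (trans (place-≢ p _ (≢-sym (↑ˡ≢↑ʳ t k))) (pins t))
    in c∉S (subst (_∈ S) (≡.sym (≡′⇒≡ c'≡σ't)) (∈-tabulate⁺ t))

  Separated : Fin n → Fin n → Fin n' → Fin n' → ℕ → Set
  Separated a b a' b' ℓ = W.Walk a b ℓ × (∀ {m} → m ≤ ℓ → ¬ W'.Walk a' b' m)

  spoiler-wins-separated : ∀ r {ℓ a b a' b'} {i j k : Fin 3} (p : Position n n' (f + 3)) →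
    i ≢ j → j ≢ k → k ≢ i → Pins σ σ' p → p (f ↑ʳ i) ≡ just (a , a') → p (f ↑ʳ j) ≡ just (b , b') →
    Separated a b a' b' ℓ → ℓ ≤ 2 ^ r → SpoilerWins G G' r p
  spoiler-wins-separated r _ _ _ _ _ pa pb (W.nil , none) _ = ¬PartialIso⇒SpoilerWins r λ iso →
    none z≤n (subst (λ b' → W'.Walk _ b' 0) (proj₁ (proj₁ (iso _ _ _ _ _ _ pa pb)) refl) W'.nil)
  spoiler-wins-separated r _ _ _ _ _ pa pb (W.edge e , none) _ = ¬PartialIso⇒SpoilerWins r λ iso →
    none ≤-refl (W'.edge (trans (≡.sym (proj₂ (iso _ _ _ _ _ _ pa pb))) e))
  spoiler-wins-separated zero _ _ _ _ _ _ _ (W.cons _ _ _ , _) (s≤s ())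
  spoiler-wins-separated (suc r) {ℓ@(suc (suc m))} {a} {b} {a'} {b'} {k = k} p
    i≢j j≢k k≢i pins pa pb (W , none) ℓ≤2^[1+r]
    with W.split ⌊ m /2⌋ (subst (W.Walk a b) (≡.sym (⌊n/2⌋+⌈n/2⌉≡n ℓ)) W)
  ... | c , c∉S , first , second = inj₂ (f ↑ʳ k , inj₁ (c , respond))
    where
    ⌈ℓ/2⌉≤2^r : ⌈ ℓ /2⌉ ≤ 2 ^ r
    ⌈ℓ/2⌉≤2^r = m≤2*n⇒⌈m/2⌉≤n ℓ≤2^[1+r]

    respond : ∀ c' → SpoilerWins G G' r (place p (f ↑ʳ k) (c , c'))
    respond c' with any? (c' Fin.≟_) S'
    ... | yes c'∈S' = ¬PartialIso⇒SpoilerWins r (pinned-conflict k pins c∉S c'∈S')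
    ... | no c'∉S' with anyUpTo? (W'.walk? a' c') (suc ⌊ ℓ /2⌋)
    ...   | yes (m₁ , m₁<1+ℓ₁ , W₁') =
            spoiler-wins-separated r (place p (f ↑ʳ k) (c , c')) (≢-sym j≢k) (≢-sym i≢j) (≢-sym k≢i)
              (pins-place p k _ pins) (place-≡ p (f ↑ʳ k) _) (place-moving p _ (≢-sym j≢k) pb)
              (second , no-second-half) ⌈ℓ/2⌉≤2^r
      where
      no-second-half : ∀ {m₂} → m₂ ≤ ⌈ ℓ /2⌉ → ¬ W'.Walk c' b' m₂
      no-second-half {m₂} m₂≤ℓ₂ W₂' =
        none (subst (m₁ + m₂ ≤_) (⌊n/2⌋+⌈n/2⌉≡n ℓ) (+-mono-≤ (s≤s⁻¹ m₁<1+ℓ₁) m₂≤ℓ₂))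
             (W₁' W'.++⟨ c'∉S' ⟩ W₂')
    ...   | no no-first-half =
            spoiler-wins-separated r (place p (f ↑ʳ k) (c , c')) (≢-sym k≢i) (≢-sym j≢k) (≢-sym i≢j)
              (pins-place p k _ pins) (place-moving p _ k≢i pa) (place-≡ p (f ↑ʳ k) _)
              (first , λ m≤ℓ₁ W₁' → no-first-half (_ , s≤s m≤ℓ₁ , W₁'))
              (≤-trans (⌊n/2⌋≤⌈n/2⌉ ℓ) ⌈ℓ/2⌉≤2^r)

  separated : ∀ {a b a' b' ℓ d'} → IsDist G S a b (just ℓ) → IsDist G' S' a' b' d' → just ℓ ≺ d' →
    Separated a b a' b' ℓ
  separated {d' = nothing} dist dist' _ = W.isDist-walk dist , λ _ → W'.isDist-∞ dist'
  separated {d' = just ℓ'} dist dist' ℓ<ℓ' =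
    W.isDist-walk dist , λ m≤ℓ W' → <⇒≱ ℓ<ℓ' (≤-trans (W'.isDist-≤ dist' W') m≤ℓ)

  spoiler-wins-≺ : ∀ r {a b a' b' d d'} {i j k : Fin 3} (p : Position n n' (f + 3)) →
    i ≢ j → j ≢ k → k ≢ i → Pins σ σ' p → p (f ↑ʳ i) ≡ just (a , a') → p (f ↑ʳ j) ≡ just (b , b') →
    IsDist G S a b d → IsDist G' S' a' b' d' → d ≺ d' → All (_≤ 2 ^ r) d → SpoilerWins G G' r p
  spoiler-wins-≺ r p i≢j j≢k k≢i pins pa pb dist dist' d≺d' (just ℓ≤2^r) =
    spoiler-wins-separated r p i≢j j≢k k≢i pins pa pb (separated dist dist' d≺d') ℓ≤2^r

module _ {n n' f} (G : Graph n) (G' : Graph n') (σ : Fin f → Fin n) (σ' : Fin f → Fin n') where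
  private
    S = tabulate σ
    S' = tabulate σ'
    module W = AvoidingWalks G S
    module W' = AvoidingWalks G' S'
    module B = Bisection G G' σ σ'
    module B' = Bisection G' G σ' σ

  spoiler-wins-d₀ : ∀ r {a b a' b' d d'} {i j k : Fin 3} (p : Position n n' (f + 3)) →
    i ≢ j → j ≢ k → k ≢ i → Pins σ σ' p → p (f ↑ʳ i) ≡ just (a , a') → p (f ↑ʳ j) ≡ just (b , b') →
    IsDist G S a b d → IsDist G' S' a' b' d' → d ≢ d' → All (_≤ n) d' → n ≤ 2 ^ r → SpoilerWins G G' r p
  spoiler-wins-d₀ r p i≢j j≢k k≢i pins pa pb dist dist' d≢d' d'≤n n≤2^r with ≢⇒≺⊎≻ d≢d'
  ... | inj₁ d≺d' = B.spoiler-wins-≺ r p i≢j j≢k k≢i pins pa pb dist dist' d≺d'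
    (All.map (λ ℓ<n → ≤-trans (<⇒≤ ℓ<n) n≤2^r) (W.isDist-< dist))
  ... | inj₂ d'≺d = spoiler-wins-swap r (λ _ → refl)
    (B'.spoiler-wins-≺ r (swap p) i≢j j≢k k≢i (swap-just p ∘ pins) (swap-just p pa) (swap-just p pb)
      dist' dist d'≺d
      (All.map (λ ℓ'≤n → ≤-trans ℓ'≤n n≤2^r) d'≤n))

  spoiler-wins-far : ∀ r {a a' b' d'} {i j k : Fin 3} (p : Position n n' (f + 3)) →
    i ≢ j → j ≢ k → k ≢ i → Pins σ σ' p → p (f ↑ʳ i) ≡ just (a , a') →
    IsDist G' S' a' b' d' → ¬ All (_≤ n) d' → n ≤ 2 ^ r → SpoilerWins G G' (suc r) p
  spoiler-wins-far r {d' = nothing} _ _ _ _ _ _ _ d'≰n _ = contradiction nothing d'≰n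
  spoiler-wins-far r {a} {a'} {b'} {just _} {k = k} p i≢j j≢k k≢i pins pa dist' ℓ'≰n n≤2^r =
    inj₂ (f ↑ʳ k , inj₂ (x' , respond))
    where
    at-distance-n : ∃ λ x' → IsDist G' S' a' x' (just n)
    at-distance-n =
      let o , 1+n+o≡ℓ' = m≤n⇒∃[o]m+o≡n (≰⇒> (ℓ'≰n ∘ just))
      in W'.isDist-prefix n
           (subst (λ ℓ → IsDist G' S' a' b' (just ℓ)) (≡.sym (trans (+-suc n o) 1+n+o≡ℓ')) dist')
    x' = proj₁ at-distance-n

    ≢n : ∀ {d} → All (_< n) d → d ≢ just n
    ≢n (just n<n) refl = <-irrefl refl n<n

    respond : ∀ x → SpoilerWins G G' r (place p (f ↑ʳ k) (x , x'))
    respond x =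
      let d , dist = W.d₀ a x
      in spoiler-wins-d₀ r (place p (f ↑ʳ k) (x , x')) (≢-sym k≢i) (≢-sym j≢k) (≢-sym i≢j)
           (B.pins-place p k _ pins) (B.place-moving p _ k≢i pa) (place-≡ p (f ↑ʳ k) _)
           dist (proj₂ at-distance-n) (≢n (W.isDist-< dist)) (just ≤-refl) n≤2^r

  spoiler-wins : ∀ {a b a' b'} (p : Position n n' (f + 3)) → 2 ≤ n → Pins σ σ' p →
    p (f ↑ʳ # 0) ≡ just (a , a') → p (f ↑ʳ # 1) ≡ just (b , b') →
    (∀ d d' → IsDist G S a b d → IsDist G' S' a' b' d' → d ≢ d') →
    Σ ℕ λ r → 2 ^ (r ∸ 2) < n × SpoilerWins G G' r p
  spoiler-wins {a} {b} {a'} {b'} p 2≤n pins pa pb d₀≢ with W.d₀ a b | W'.d₀ a' b' | tight-power-of-2 2≤n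
  ... | d , dist | d' , dist' | R , n≤2^R , 2^[R∸1]<n with All.dec (_≤? n) d'
  ...   | yes d'≤n =
          R , ≤-<-trans (^-monoʳ-≤ 2 (∸-monoʳ-≤ R (s≤s z≤n))) 2^[R∸1]<n ,
          spoiler-wins-d₀ R {k = # 2} p (λ ()) (λ ()) (λ ()) pins pa pb dist dist'
            (d₀≢ d d' dist dist') d'≤n n≤2^R
  ...   | no d'≰n =
          suc R , 2^[R∸1]<n ,
          spoiler-wins-far R {j = # 1} {k = # 2} p (λ ()) (λ ()) (λ ()) pins pa dist' d'≰n n≤2^R

lemma7 : ∀ {n n'} (G : Graph n) (G' : Graph n')
    → Triconnected G → Triconnected G' → ¬ Isomorphic G G'
    → (E : Embedding G) (E' : Embedding G')
    → (C : Config G) (C' : Config G')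
    → Collocated E C → Twisted E' C'
    → (a b : Fin n) (a' b' : Fin n')
    → (∀ d d' → IsDist G (vertices C) a b d → IsDist G' (vertices C') a' b' d' → d ≢ d')
    → (p : Position n n' 9)
    → p (# 0) ≡ just (x C , x C') → p (# 1) ≡ just (y C , y C')
    → p (# 2) ≡ just (z C , z C') → p (# 3) ≡ just (u C , u C')
    → p (# 4) ≡ just (v C , v C') → p (# 5) ≡ just (w C , w C')
    → p (# 6) ≡ just (a , a') → p (# 7) ≡ just (b , b')
    → Σ ℕ λ r → (2 ^ (r ∸ 2) < n) × SpoilerWins G G' r p
lemma7 G G' (4≤n , _) _ _ _ _ C C' _ _ a b a' b' d₀≢ p px py pz pu pv pw pa pb =
  spoiler-wins G G' (lookup (vertices C)) (lookup (vertices C')) p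
    (≤-trans (s≤s (s≤s z≤n)) 4≤n) pins pa pb d₀≢
  where
  pins : Pins (lookup (vertices C)) (lookup (vertices C')) p
  pins fzero = px
  pins (fsuc fzero) = py
  pins (fsuc (fsuc fzero)) = pz
  pins (fsuc (fsuc (fsuc fzero))) = pu
  pins (fsuc (fsuc (fsuc (fsuc fzero)))) = pv
  pins (fsuc (fsuc (fsuc (fsuc (fsuc fzero))))) = pw
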